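{- Let $\ell$ be an odd positive integer, $n=\lceil 2^\ell/4\rceil$, and let $G_1,G_2$ be the weighted graphs defined below, with spectral densities $p_1,p_2$. Then $m_j(p_i)\in[1/2,1]$ for all integers $j\ge 0$ and $i\in\{1,2\}$, and $|m_j(p_1)-m_j(p_2)| = 0$ for $j<\ell$, while $|m_j(p_1)-m_j(p_2)|\le 2^{ -\ell+1}$ for $j\ge\ell$.
   Context: $G_1$: start with $2n\ell$ isolated vertices and $2n$ disjoint cycles each with $\ell$ vertices. $G_2$: start with $2n\ell$ isolated vertices and $n$ disjoint cycles each with $2\ell$ vertices. In both graphs, each cycle edge gets weight $1/4$, and then every vertex lying on a cycle is connected to every cycle vertex (including itself, via a self-loop) by an additional edge of weight $1/(4n\ell)$; each isolated vertex has only a self-loop of weight $1$. Each graph has $4n\ell$ vertices. For a weighted graph with weighted adjacency matrix $\tilde A$ (self-loop weights on the diagonal) and diagonal degree matrix $D$ of row sums of $\tilde A$, the normalized adjacency matrix is $A=D^{ -1/2}\tilde A D^{ -1/2}$; the spectral density $p$ is the uniform distribution over its eigenvalues (with multiplicity), and $m_j(p)=\int x^j\,dp(x)=\frac{1}{N}\mathrm{tr}(A^j)$ for an $N$-vertex graph. -}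

module Defs where

open import Data.Bool using (Bool; true; false; if_then_else_; _∧_)
open import Data.Nat as ℕ using (ℕ; zero; suc; _<ᵇ_; _≡ᵇ_)
open import Data.Nat.DivMod as ND using ()
open import Data.Fin using (Fin; toℕ) renaming (zero to fzero; suc to fsuc)
open import Data.Integer using (+_)
open import Data.Rational using (ℚ; 0ℚ; 1ℚ; _+_; _*_; _/_; _<_)
open import Data.Product using (_×_)
open import Relation.Binary.PropositionalEquality using (_≡_)

-- Rational reciprocal of a natural number (value 0 at 0; only used at
-- positive arguments in the statement).
inv : ℕ → ℚ
inv zero    = 0ℚ
inv (suc m) = + 1 / suc m

ind : Bool → ℚ
ind true  = 1ℚ
ind false = 0ℚ

ceil4 : ℕ → ℕ
ceil4 m = (m ℕ.+ 3) ND./ 4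

sumFin : (N : ℕ) → (Fin N → ℚ) → ℚ
sumFin zero    f = 0ℚ
sumFin (suc N) f = f fzero + sumFin N (λ i → f (fsuc i))

Mat : ℕ → Set
Mat N = Fin N → Fin N → ℚ

identity : (N : ℕ) → Mat N
identity N i j = ind (toℕ i ≡ᵇ toℕ j)

_⊗_ : {N : ℕ} → Mat N → Mat N → Mat N
_⊗_ {N} A B i j = sumFin N (λ k → A i k * B k j)

matPow : {N : ℕ} → Mat N → ℕ → Mat N
matPow {N} A zero    = identity N
matPow {N} A (suc j) = A ⊗ matPow A j

trace : {N : ℕ} → Mat N → ℚ
trace {N} A = sumFin N (λ i → A i i)

-- j-th moment of the spectral density: (1/N) tr(A^j).
moment : {N : ℕ} → Mat N → ℕ → ℚ
moment {N} A j = inv N * trace (matPow A j)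

-- Vertices of the cycle part are the naturals a < B (B = 2nℓ), grouped
-- into consecutive blocks of length c: vertex a lies on cycle a / c at
-- position a % c.  cycSucc c a b: b is the successor of a on its cycle.
cycSucc : ℕ → ℕ → ℕ → Bool
cycSucc zero    a b = false
cycSucc (suc c) a b =
  (a ND./ suc c ≡ᵇ b ND./ suc c) ∧ (((a ℕ.% suc c) ℕ.+ 1) ℕ.% suc c ≡ᵇ b ℕ.% suc c)

-- Weighted adjacency matrix of the graph on N = 4nℓ vertices built from
-- B = 2nℓ cycle vertices partitioned into cycles of length c, plus
-- 2nℓ isolated vertices with a self-loop of weight 1.  Each cycle edge
-- (a, succ a) has weight 1/4 (recorded symmetrically); every pair of cycle
-- vertices (including a vertex with itself) gets an extra 1/(4nℓ).
cycleGraph : (n ℓ c : ℕ) → Mat (4 ℕ.* n ℕ.* ℓ)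
cycleGraph n ℓ c i j =
  let a = toℕ i ; b = toℕ j ; B = 2 ℕ.* n ℕ.* ℓ in
  if (a <ᵇ B) ∧ (b <ᵇ B)
  then ((+ 1 / 4) * ind (cycSucc c a b) + (+ 1 / 4) * ind (cycSucc c b a))
         + inv (4 ℕ.* n ℕ.* ℓ)
  else (if (B ℕ.≤ᵇ a) ∧ (a ≡ᵇ b) then 1ℚ else 0ℚ)

-- G₁: 2n cycles of length ℓ;  G₂: n cycles of length 2ℓ.
G₁ G₂ : (n ℓ : ℕ) → Mat (4 ℕ.* n ℕ.* ℓ)
G₁ n ℓ = cycleGraph n ℓ ℓ
G₂ n ℓ = cycleGraph n ℓ (2 ℕ.* ℓ)

degree : {N : ℕ} → Mat N → Fin N → ℚ
degree {N} W i = sumFin N (W i)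

-- S is the diagonal of D^{-1/2}: positive with S_i² · deg_i = 1.
IsInvSqrtDegree : {N : ℕ} → Mat N → (Fin N → ℚ) → Set
IsInvSqrtDegree {N} W S = (i : Fin N) → (0ℚ < S i) × (S i * S i * degree W i ≡ 1ℚ)

normalized : {N : ℕ} → Mat N → (Fin N → ℚ) → Mat N
normalized W S i j = S i * W i j * S j

{-# OPTIONS --safe #-}
-- Every vertex has weighted degree 1, so the normalization is trivial and the
-- j-th moment is (1/N) tr Wʲ.  On the B = 2nℓ cycle vertices W = M + J/N, where
-- M = (P + Pᵀ)/4 for the cyclic shift P and J is the all-ones matrix; since W is
-- symmetric with unit row sums, every cycle column of Wʲ is the column of Mʲ plus
-- a constant uⱼ with u₍ⱼ₊₁₎ = uⱼ/2 + 1/N.  A diagonal entry of Mʲ is 4⁻ʲ times the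
-- number of closed ±1-walks of length j around its cycle, so it lies in [0, 2⁻ʲ],
-- and for j below the cycle length no closed walk winds around, so it equals the
-- return weight of the walk on ℤ for both cycle lengths ℓ and 2ℓ.  With uⱼ + 2⁻ʲ ≤ 1
-- and the isolated half of the vertices contributing exactly 1/2, the bounds follow.
module Submission where

open import Defs
open import Data.Bool using (Bool; true; false; T; if_then_else_)
open import Data.Bool.Properties using (T-∧)
open import Data.Empty using (⊥-elim)
open import Data.Fin using (Fin; toℕ; fromℕ<) renaming (zero to fzero; suc to fsuc)
open import Data.Fin.Properties using (toℕ-fromℕ<)
open import Data.Integer as ℤ using (ℤ; +_; -[1+_]; _⊖_)
import Data.Integer.Properties as ℤ
open import Data.Nat as ℕ using (ℕ; zero; suc; _%_; _^_; _<ᵇ_; _≡ᵇ_)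
import Data.Nat.Properties as ℕ
import Data.Nat.DivMod as ℕ
import Data.Nat.Coprimality as Coprime
open import Data.Product using (_×_; _,_; proj₁; proj₂)
open import Data.Rational
open import Data.Rational.Properties
open import Data.Rational.Solver
open import Data.Sum using (inj₁; inj₂)
open import Relation.Binary.Definitions using (tri<; tri≈; tri>)
open import Function using (_∘_; Equivalence)
open import Relation.Binary.PropositionalEquality
open import Relation.Nullary using (¬_; yes; no)
open +-*-Solver

fromℕ : ℕ → ℚ
fromℕ zero    = 0ℚ
fromℕ (suc k) = 1ℚ + fromℕ k

fromℕ-+ : ∀ a b → fromℕ (a ℕ.+ b) ≡ fromℕ a + fromℕ b
fromℕ-+ zero    b = sym (+-identityˡ (fromℕ b))
fromℕ-+ (suc a) b rewrite fromℕ-+ a b = sym (+-assoc 1ℚ (fromℕ a) (fromℕ b))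

fromℕ-* : ∀ a b → fromℕ (a ℕ.* b) ≡ fromℕ a * fromℕ b
fromℕ-* zero    b = sym (*-zeroˡ (fromℕ b))
fromℕ-* (suc a) b rewrite fromℕ-+ b (a ℕ.* b) | fromℕ-* a b =
  solve 2 (λ x y → y :+ x :* y := (con 1ℚ :+ x) :* y) refl (fromℕ a) (fromℕ b)

fromℕ-nonNeg : ∀ a → 0ℚ ≤ fromℕ a
fromℕ-nonNeg zero    = ≤-refl
fromℕ-nonNeg (suc a) = ≤-trans (fromℕ-nonNeg a)
  (subst (_≤ 1ℚ + fromℕ a) (+-identityˡ (fromℕ a)) (+-monoˡ-≤ (fromℕ a) (nonNegative⁻¹ 1ℚ)))

1≤fromℕ : ∀ a → 0 ℕ.< a → 1ℚ ≤ fromℕ a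
1≤fromℕ (suc a) _ = subst (_≤ fromℕ (suc a)) (+-identityʳ 1ℚ) (+-monoʳ-≤ 1ℚ (fromℕ-nonNeg a))

fromℕ≡mkℚ : ∀ k → fromℕ k ≡ mkℚ (+ k) 0 (Coprime.sym (Coprime.1-coprimeTo k))
fromℕ≡mkℚ zero    = refl
fromℕ≡mkℚ (suc k) rewrite fromℕ≡mkℚ k =
  trans (/-cong {p₂ = + suc k} (cong (ℤ._+_ (+ 1)) (ℤ.*-identityʳ (+ k))) refl) (normalize-coprime _)

fromℕ*inv : ∀ a → 0 ℕ.< a → fromℕ a * inv a ≡ 1ℚ
fromℕ*inv (suc m) _
  rewrite fromℕ≡mkℚ (suc m) | normalize-coprime {1} {m} (Coprime.1-coprimeTo (suc m)) =
  *-inverseʳ (mkℚ (+ suc m) 0 (Coprime.sym (Coprime.1-coprimeTo (suc m))))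

inv-nonNeg : ∀ m → 0ℚ ≤ inv m
inv-nonNeg zero    = ≤-refl
inv-nonNeg (suc m) = nonNegative⁻¹ _ {{normalize-nonNeg 1 (suc m)}}

sumFin-cong : ∀ N {f g : Fin N → ℚ} → (∀ i → f i ≡ g i) → sumFin N f ≡ sumFin N g
sumFin-cong zero    eq = refl
sumFin-cong (suc N) eq = cong₂ _+_ (eq fzero) (sumFin-cong N (λ i → eq (fsuc i)))

sumFin-+ : ∀ N (f g : Fin N → ℚ) → sumFin N (λ i → f i + g i) ≡ sumFin N f + sumFin N g
sumFin-+ zero    f g = refl
sumFin-+ (suc N) f g rewrite sumFin-+ N (λ i → f (fsuc i)) (λ i → g (fsuc i)) =
  solve 4 (λ a b c d → (a :+ b) :+ (c :+ d) := (a :+ c) :+ (b :+ d)) refl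
    (f fzero) (g fzero) (sumFin N (λ i → f (fsuc i))) (sumFin N (λ i → g (fsuc i)))

sumFin-minus : ∀ N (f g : Fin N → ℚ) → sumFin N (λ i → f i - g i) ≡ sumFin N f - sumFin N g
sumFin-minus zero    f g = refl
sumFin-minus (suc N) f g rewrite sumFin-minus N (λ i → f (fsuc i)) (λ i → g (fsuc i)) =
  solve 4 (λ a b c d → (a :- b) :+ (c :- d) := (a :+ c) :- (b :+ d)) refl
    (f fzero) (g fzero) (sumFin N (λ i → f (fsuc i))) (sumFin N (λ i → g (fsuc i)))

sumFin-*ˡ : ∀ N a (f : Fin N → ℚ) → sumFin N (λ i → a * f i) ≡ a * sumFin N f
sumFin-*ˡ zero    a f = sym (*-zeroʳ a)
sumFin-*ˡ (suc N) a f rewrite sumFin-*ˡ N a (λ i → f (fsuc i)) = sym (*-distribˡ-+ a _ _)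

sumFin-const : ∀ N b → sumFin N (λ _ → b) ≡ fromℕ N * b
sumFin-const zero    b = sym (*-zeroˡ b)
sumFin-const (suc N) b rewrite sumFin-const N b =
  solve 2 (λ x y → y :+ x :* y := (con 1ℚ :+ x) :* y) refl (fromℕ N) b

sumFin-comm : ∀ N M (f : Fin N → Fin M → ℚ) →
  sumFin N (λ i → sumFin M (f i)) ≡ sumFin M (λ j → sumFin N (λ i → f i j))
sumFin-comm zero    M f = sym (trans (sumFin-const M 0ℚ) (*-zeroʳ (fromℕ M)))
sumFin-comm (suc N) M f rewrite sumFin-comm N M (λ i → f (fsuc i)) =
  sym (sumFin-+ M (f fzero) (λ j → sumFin N (λ i → f (fsuc i) j)))

sumFin-mono-≤ : ∀ N {f g : Fin N → ℚ} → (∀ i → f i ≤ g i) → sumFin N f ≤ sumFin N g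
sumFin-mono-≤ zero    le = ≤-refl
sumFin-mono-≤ (suc N) le = +-mono-≤ (le fzero) (sumFin-mono-≤ N (λ i → le (fsuc i)))

sumFin-select : ∀ N (x : Fin N) (f : Fin N → ℚ) → sumFin N (λ m → ind (toℕ x ≡ᵇ toℕ m) * f m) ≡ f x
sumFin-select (suc N) fzero f =
  trans (cong₂ _+_ (*-identityˡ (f fzero))
          (trans (sumFin-cong N (λ i → *-zeroˡ (f (fsuc i)))) (trans (sumFin-const N 0ℚ) (*-zeroʳ (fromℕ N)))))
        (+-identityʳ (f fzero))
sumFin-select (suc N) (fsuc x) f =
  trans (cong₂ _+_ (*-zeroˡ (f fzero)) (sumFin-select N x (λ i → f (fsuc i)))) (+-identityˡ _)

sumFin-selectℕ : ∀ N s → s ℕ.< N → (F : ℕ → ℚ) → sumFin N (λ m → ind (s ≡ᵇ toℕ m) * F (toℕ m)) ≡ F s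
sumFin-selectℕ N s s<N F =
  subst (λ z → sumFin N (λ m → ind (z ≡ᵇ toℕ m) * F (toℕ m)) ≡ F z) (toℕ-fromℕ< s<N)
        (sumFin-select N (fromℕ< s<N) (F ∘ toℕ))

sumFin-if-< : ∀ N B a b → B ℕ.≤ N →
  sumFin N (λ m → if toℕ m <ᵇ B then a else b) ≡ fromℕ B * a + fromℕ (N ℕ.∸ B) * b
sumFin-if-< zero    zero    a b _ = solve 2 (λ a b → con 0ℚ := con 0ℚ :* a :+ con 0ℚ :* b) refl a b
sumFin-if-< (suc N) zero    a b _ = trans (sumFin-const (suc N) b)
  (solve 3 (λ a b x → x :* b := con 0ℚ :* a :+ x :* b) refl a b (fromℕ (suc N)))
sumFin-if-< (suc N) (suc B) a b (ℕ.s≤s B≤N) rewrite sumFin-if-< N B a b B≤N =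
  solve 4 (λ a b x y → a :+ (x :* a :+ y :* b) := (con 1ℚ :+ x) :* a :+ y :* b) refl
    a b (fromℕ B) (fromℕ (N ℕ.∸ B))

matPow-cong : ∀ {N} {A A′ : Mat N} → (∀ i k → A i k ≡ A′ i k) → ∀ j i k → matPow A j i k ≡ matPow A′ j i k
matPow-cong         eq zero    i k = refl
matPow-cong {N} eq (suc j) i k = sumFin-cong N (λ m → cong₂ _*_ (eq i m) (matPow-cong eq j m k))

s*s≡1⇒s≡1 : ∀ {s} → 0ℚ < s → s * s ≡ 1ℚ → s ≡ 1ℚ
s*s≡1⇒s≡1 {s} 0<s s*s≡1 with <-cmp s 1ℚ
... | tri≈ _ s≡1 _ = s≡1
... | tri< s<1 _ _ = ⊥-elim (<-irrefl refl (begin-strict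
  1ℚ      ≡⟨ s*s≡1 ⟨
  s * s   <⟨ *-monoˡ-<-pos s {{positive 0<s}} s<1 ⟩
  1ℚ * s  ≡⟨ *-identityˡ s ⟩
  s       <⟨ s<1 ⟩
  1ℚ      ∎))
  where open ≤-Reasoning
... | tri> _ _ 1<s = ⊥-elim (<-irrefl refl (begin-strict
  1ℚ      <⟨ 1<s ⟩
  s       ≡⟨ *-identityˡ s ⟨
  1ℚ * s  <⟨ *-monoˡ-<-pos s {{positive 0<s}} 1<s ⟩
  s * s   ≡⟨ s*s≡1 ⟩
  1ℚ      ∎))
  where open ≤-Reasoning

invSqrtDegree≡1 : ∀ {N} {W : Mat N} {S : Fin N → ℚ} →
  (∀ i → degree W i ≡ 1ℚ) → IsInvSqrtDegree W S → ∀ i → S i ≡ 1ℚ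
invSqrtDegree≡1 {W = W} {S} degree≡1 isInvSqrt i with isInvSqrt i
... | 0<Sᵢ , Sᵢ*Sᵢ*dᵢ≡1 = s*s≡1⇒s≡1 0<Sᵢ (begin
  S i * S i                  ≡⟨ *-identityʳ (S i * S i) ⟨
  S i * S i * 1ℚ             ≡⟨ cong (S i * S i *_) (degree≡1 i) ⟨
  S i * S i * degree W i     ≡⟨ Sᵢ*Sᵢ*dᵢ≡1 ⟩
  1ℚ                         ∎)
  where open ≡-Reasoning

moment-normalized : ∀ {N} (W : Mat N) {S : Fin N → ℚ} → (∀ i → S i ≡ 1ℚ) →
  ∀ j → moment (normalized W S) j ≡ moment W j
moment-normalized {N} W {S} S≡1 j = cong (inv N *_) (sumFin-cong N (λ i → matPow-cong unscaled j i i))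
  where
  unscaled : ∀ i k → normalized W S i k ≡ W i k
  unscaled i k rewrite S≡1 i | S≡1 k = trans (*-identityʳ _) (*-identityˡ _)

¼ : ℚ
¼ = + 1 / 4

½^ : ℕ → ℚ
½^ zero    = 1ℚ
½^ (suc j) = ½ * ½^ j

½^-nonNeg : ∀ j → 0ℚ ≤ ½^ j
½^-nonNeg zero    = nonNegative⁻¹ 1ℚ
½^-nonNeg (suc j) = *-monoˡ-≤-nonNeg ½ (½^-nonNeg j)

½≤1 : ½ ≤ 1ℚ
½≤1 = *≤* (ℤ.+≤+ (ℕ.s≤s ℕ.z≤n))

1≤2 : 1ℚ ≤ + 2 / 1
1≤2 = *≤* (ℤ.+≤+ (ℕ.s≤s ℕ.z≤n))

¼-mono-≤ : ∀ {x y x′ y′} → x ≤ x′ → y ≤ y′ → ¼ * (x + y) ≤ ¼ * (x′ + y′)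
¼-mono-≤ x≤x′ y≤y′ = *-monoˡ-≤-nonNeg ¼ (+-mono-≤ x≤x′ y≤y′)

ind-bounds : ∀ b → 0ℚ ≤ ind b × ind b ≤ 1ℚ
ind-bounds true  = nonNegative⁻¹ 1ℚ , ≤-refl
ind-bounds false = ≤-refl , nonNegative⁻¹ 1ℚ

difference-bounds : ∀ {u v a p} → 0ℚ ≤ u → u ≤ p → 0ℚ ≤ v → v ≤ p →
  - p ≤ (u + a) - (v + a) × (u + a) - (v + a) ≤ p
difference-bounds {u} {v} {a} {p} 0≤u u≤p 0≤v v≤p =
  subst₂ _≤_ (+-identityˡ (- p)) (sym cancel) (+-mono-≤ 0≤u (neg-antimono-≤ v≤p)) ,
  subst₂ _≤_ (sym cancel) (+-identityʳ p) (+-mono-≤ u≤p (neg-antimono-≤ 0≤v))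
  where
  cancel : (u + a) - (v + a) ≡ u - v
  cancel = solve 3 (λ u v a → (u :+ a) :- (v :+ a) := u :- v) refl u v a

∣p∣≤q : ∀ {p q} → - q ≤ p → p ≤ q → ∣ p ∣ ≤ q
∣p∣≤q {p} {q} -q≤p p≤q with ∣p∣≡p∨∣p∣≡-p p
... | inj₁ ∣p∣≡p  = subst (_≤ q) (sym ∣p∣≡p) p≤q
... | inj₂ ∣p∣≡-p = subst₂ _≤_ (sym ∣p∣≡-p) (solve 1 (λ q → :- (:- q) := q) refl q) (neg-antimono-≤ -q≤p)

½^-suc-≤ : ∀ j → ½^ (suc j) ≤ ½^ j
½^-suc-≤ j = subst (½^ (suc j) ≤_) (*-identityˡ (½^ j))
  (*-monoʳ-≤-nonNeg (½^ j) {{nonNegative (½^-nonNeg j)}} ½≤1)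

½^-antitone : ∀ {i j} → i ℕ.≤ j → ½^ j ≤ ½^ i
½^-antitone = antitone′ ∘ ℕ.≤⇒≤′
  where
  antitone′ : ∀ {i j} → i ℕ.≤′ j → ½^ j ≤ ½^ i
  antitone′ ℕ.≤′-refl                    = ≤-refl
  antitone′ (ℕ.≤′-step {n = j} i≤′j) = ≤-trans (½^-suc-≤ j) (antitone′ i≤′j)

½^≡inv2^ : ∀ j → ½^ j ≡ inv (2 ^ j)
½^≡inv2^ j = begin
  ½^ j                              ≡⟨ *-identityʳ (½^ j) ⟨
  ½^ j * 1ℚ                         ≡⟨ cong (½^ j *_) (fromℕ*inv (2 ^ j) (ℕ.m^n>0 2 j)) ⟨
  ½^ j * (fromℕ (2 ^ j) * inv (2 ^ j)) ≡⟨ *-assoc (½^ j) _ _ ⟨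
  ½^ j * fromℕ (2 ^ j) * inv (2 ^ j) ≡⟨ cong (_* inv (2 ^ j)) (½^*2^≡1 j) ⟩
  1ℚ * inv (2 ^ j)                  ≡⟨ *-identityˡ _ ⟩
  inv (2 ^ j)                       ∎
  where
  open ≡-Reasoning
  ½^*2^≡1 : ∀ j → ½^ j * fromℕ (2 ^ j) ≡ 1ℚ
  ½^*2^≡1 zero    = refl
  ½^*2^≡1 (suc j) rewrite fromℕ-* 2 (2 ^ j) =
    trans (solve 2 (λ p t → con ½ :* p :* (con (fromℕ 2) :* t) := p :* t) refl (½^ j) (fromℕ (2 ^ j)))
          (½^*2^≡1 j)

½*½^j≤inv2^ℓ*2 : ∀ {ℓ j} → ℓ ℕ.≤ j → ½ * ½^ j ≤ inv (2 ^ ℓ) * (+ 2 / 1)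
½*½^j≤inv2^ℓ*2 {ℓ} {j} ℓ≤j = begin
  ½^ (suc j)            ≤⟨ ½^-antitone (ℕ.m≤n⇒m≤1+n ℓ≤j) ⟩
  ½^ ℓ                  ≡⟨ *-identityʳ (½^ ℓ) ⟨
  ½^ ℓ * 1ℚ             ≤⟨ *-monoˡ-≤-nonNeg (½^ ℓ) {{nonNegative (½^-nonNeg ℓ)}} 1≤2 ⟩
  ½^ ℓ * (+ 2 / 1)      ≡⟨ cong (_* (+ 2 / 1)) (½^≡inv2^ ℓ) ⟩
  inv (2 ^ ℓ) * (+ 2 / 1) ∎
  where open ≤-Reasoning

T⇒≡true : ∀ {b} → T b → b ≡ true
T⇒≡true {true} _ = refl

¬T⇒≡false : ∀ {b} → ¬ T b → b ≡ false
¬T⇒≡false {false} _  = refl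
¬T⇒≡false {true}  ¬t = ⊥-elim (¬t _)

<ᵇ-true : ∀ {a b} → a ℕ.< b → (a <ᵇ b) ≡ true
<ᵇ-true = T⇒≡true ∘ ℕ.<⇒<ᵇ

<ᵇ-false : ∀ {a b} → b ℕ.≤ a → (a <ᵇ b) ≡ false
<ᵇ-false {a} {b} b≤a = ¬T⇒≡false (ℕ.≤⇒≯ b≤a ∘ ℕ.<ᵇ⇒< a b)

≤ᵇ-true : ∀ {a b} → a ℕ.≤ b → (a ℕ.≤ᵇ b) ≡ true
≤ᵇ-true = T⇒≡true ∘ ℕ.≤⇒≤ᵇ

≤ᵇ-false : ∀ {a b} → b ℕ.< a → (a ℕ.≤ᵇ b) ≡ false
≤ᵇ-false {a} {b} b<a = ¬T⇒≡false (ℕ.<⇒≱ b<a ∘ ℕ.≤ᵇ⇒≤ a b)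

≡ᵇ-false : ∀ {a b} → a ≢ b → (a ≡ᵇ b) ≡ false
≡ᵇ-false {a} {b} a≢b = ¬T⇒≡false (a≢b ∘ ℕ.≡ᵇ⇒≡ a b)

≡ᵇ-comm : ∀ m n → (m ≡ᵇ n) ≡ (n ≡ᵇ m)
≡ᵇ-comm zero    zero    = refl
≡ᵇ-comm zero    (suc n) = refl
≡ᵇ-comm (suc m) zero    = refl
≡ᵇ-comm (suc m) (suc n) = ≡ᵇ-comm m n

≡-from-T : {x y : Bool} → (T x → T y) → (T y → T x) → x ≡ y
≡-from-T {false} {false} _   _   = refl
≡-from-T {false} {true}  _   y⇒x = ⊥-elim (y⇒x _)
≡-from-T {true}  {false} x⇒y _   = ⊥-elim (x⇒y _)
≡-from-T {true}  {true}  _   _   = refl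

-- Walks on ℤ and on cycles

lineWalk : ℕ → ℤ → ℚ
lineWalk zero    (+ zero)   = 1ℚ
lineWalk zero    (+ suc _)  = 0ℚ
lineWalk zero    -[1+ _ ]   = 0ℚ
lineWalk (suc j) z          = ¼ * (lineWalk j (ℤ.suc z) + lineWalk j (ℤ.pred z))

suc-⊖ : ∀ m n → suc m ⊖ n ≡ ℤ.suc (m ⊖ n)
suc-⊖ m n = begin
  suc m ⊖ n                  ≡⟨ ℤ.m-n≡m⊖n (suc m) n ⟨
  ℤ.suc (+ m) ℤ.- + n        ≡⟨ ℤ.+-assoc (+ 1) (+ m) (ℤ.- + n) ⟩
  ℤ.suc (+ m ℤ.- + n)        ≡⟨ cong ℤ.suc (ℤ.m-n≡m⊖n m n) ⟩
  ℤ.suc (m ⊖ n)              ∎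
  where open ≡-Reasoning

⊖-suc : ∀ m n → m ⊖ suc n ≡ ℤ.pred (m ⊖ n)
⊖-suc m n = begin
  m ⊖ suc n                  ≡⟨ ℤ.m-n≡m⊖n m (suc n) ⟨
  + m ℤ.- + suc n            ≡⟨ ℤ.minus-suc (+ m) n ⟩
  ℤ.pred (+ m ℤ.- + n)       ≡⟨ cong ℤ.pred (ℤ.m-n≡m⊖n m n) ⟩
  ℤ.pred (m ⊖ n)             ∎
  where open ≡-Reasoning

lineWalk-pos : ∀ j a → j ℕ.< a → lineWalk j (+ a) ≡ 0ℚ
lineWalk-pos zero    (suc a) _            = refl
lineWalk-pos (suc j) (suc a) (ℕ.s≤s j<a)
  rewrite lineWalk-pos j (suc (suc a)) (ℕ.m<n⇒m<1+n (ℕ.m<n⇒m<1+n j<a)) | lineWalk-pos j a j<a = refl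

lineWalk-neg : ∀ j a → j ℕ.< a → lineWalk j (ℤ.- + a) ≡ 0ℚ
lineWalk-neg zero    (suc a)       _            = refl
lineWalk-neg (suc j) (suc (suc a)) (ℕ.s≤s j<a)
  rewrite lineWalk-neg j (suc a) j<a | lineWalk-neg j (suc (suc (suc a))) (ℕ.m<n⇒m<1+n (ℕ.m<n⇒m<1+n j<a)) = refl

lineWalk-above : ∀ j m n → j ℕ.+ n ℕ.< m → lineWalk j (m ⊖ n) ≡ 0ℚ
lineWalk-above j m n j+n<m rewrite ℤ.⊖-≥ (ℕ.≤-trans (ℕ.m≤n+m n (suc j)) j+n<m) =
  lineWalk-pos j (m ℕ.∸ n) (ℕ.m+n≤o⇒m≤o∸n (suc j) j+n<m)

lineWalk-below : ∀ j m n → j ℕ.+ m ℕ.< n → lineWalk j (m ⊖ n) ≡ 0ℚ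
lineWalk-below j m n j+m<n rewrite ℤ.⊖-< (ℕ.≤-trans (ℕ.s≤s (ℕ.m≤n+m m j)) j+m<n) =
  lineWalk-neg j (n ℕ.∸ m) (ℕ.m+n≤o⇒m≤o∸n (suc j) j+m<n)

lineWalk-zero : ∀ r s → lineWalk 0 (r ⊖ s) ≡ ind (r ≡ᵇ s)
lineWalk-zero zero    zero    = refl
lineWalk-zero zero    (suc s) = refl
lineWalk-zero (suc r) zero    = refl
lineWalk-zero (suc r) (suc s) rewrite ℤ.[1+m]⊖[1+n]≡m⊖n r s = lineWalk-zero r s

module Cycle (c′ : ℕ) where

  c : ℕ
  c = suc c′

  next prev : ℕ → ℕ
  next x = (x % c ℕ.+ 1)  % c ℕ.+ (x ℕ./ c) ℕ.* c
  prev x = (x % c ℕ.+ c′) % c ℕ.+ (x ℕ./ c) ℕ.* c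

  [s+qc]%c≡s : ∀ s q → s ℕ.< c → (s ℕ.+ q ℕ.* c) % c ≡ s
  [s+qc]%c≡s s q s<c = trans (ℕ.[m+kn]%n≡m%n s q c) (ℕ.m<n⇒m%n≡m s<c)

  [s+qc]/c≡q : ∀ s q → s ℕ.< c → (s ℕ.+ q ℕ.* c) ℕ./ c ≡ q
  [s+qc]/c≡q s q s<c = begin
    (s ℕ.+ q ℕ.* c) ℕ./ c       ≡⟨ ℕ.+-distrib-/ s (q ℕ.* c) (subst (ℕ._< c) (sym s%c+qc%c≡s) s<c) ⟩
    s ℕ./ c ℕ.+ q ℕ.* c ℕ./ c   ≡⟨ cong₂ ℕ._+_ (ℕ.m<n⇒m/n≡0 s<c) (ℕ.m*n/n≡m q c) ⟩
    q                           ∎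
    where
    open ≡-Reasoning
    s%c+qc%c≡s : s % c ℕ.+ (q ℕ.* c) % c ≡ s
    s%c+qc%c≡s = trans (cong₂ ℕ._+_ (ℕ.m<n⇒m%n≡m s<c) (ℕ.m*n%n≡0 q c)) (ℕ.+-identityʳ s)

  ≡-from-%-/ : ∀ x y → x % c ≡ y % c → x ℕ./ c ≡ y ℕ./ c → x ≡ y
  ≡-from-%-/ x y %≡ /≡ = begin
    x                           ≡⟨ ℕ.m≡m%n+[m/n]*n x c ⟩
    x % c ℕ.+ x ℕ./ c ℕ.* c     ≡⟨ cong₂ (λ r q → r ℕ.+ q ℕ.* c) %≡ /≡ ⟩
    y % c ℕ.+ y ℕ./ c ℕ.* c     ≡⟨ ℕ.m≡m%n+[m/n]*n y c ⟨
    y                           ∎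
    where open ≡-Reasoning

  [x%c+y]%c≡[x+y]%c : ∀ x y → (x % c ℕ.+ y) % c ≡ (x ℕ.+ y) % c
  [x%c+y]%c≡[x+y]%c x y = begin
    (x % c ℕ.+ y) % c           ≡⟨ ℕ.%-distribˡ-+ (x % c) y c ⟩
    (x % c % c ℕ.+ y % c) % c   ≡⟨ cong (λ r → (r ℕ.+ y % c) % c) (ℕ.m%n%n≡m%n x c) ⟩
    (x % c ℕ.+ y % c) % c       ≡⟨ ℕ.%-distribˡ-+ x y c ⟨
    (x ℕ.+ y) % c               ∎
    where open ≡-Reasoning

  c%c≡0 : c % c ≡ 0
  c%c≡0 = ℕ.n%n≡0 c

  [x+c]%c≡x%c : ∀ x → (x ℕ.+ c) % c ≡ x % c
  [x+c]%c≡x%c x = ℕ.[m+n]%n≡m%n x c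

  [x+1+c′]%c≡x%c : ∀ x → (x ℕ.+ 1 ℕ.+ c′) % c ≡ x % c
  [x+1+c′]%c≡x%c x = trans (cong (_% c) (ℕ.+-assoc x 1 c′)) (ℕ.[m+n]%n≡m%n x c)

  [x+c′+1]%c≡x%c : ∀ x → (x ℕ.+ c′ ℕ.+ 1) % c ≡ x % c
  [x+c′+1]%c≡x%c x = trans (cong (_% c) (trans (ℕ.+-assoc x c′ 1) (cong (x ℕ.+_) (ℕ.+-comm c′ 1))))
                           (ℕ.[m+n]%n≡m%n x c)

  next-% : ∀ x → next x % c ≡ (x % c ℕ.+ 1) % c
  next-% x = [s+qc]%c≡s _ (x ℕ./ c) (ℕ.m%n<n (x % c ℕ.+ 1) c)

  next-/ : ∀ x → next x ℕ./ c ≡ x ℕ./ c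
  next-/ x = [s+qc]/c≡q _ (x ℕ./ c) (ℕ.m%n<n (x % c ℕ.+ 1) c)

  prev-% : ∀ x → prev x % c ≡ (x % c ℕ.+ c′) % c
  prev-% x = [s+qc]%c≡s _ (x ℕ./ c) (ℕ.m%n<n (x % c ℕ.+ c′) c)

  prev-/ : ∀ x → prev x ℕ./ c ≡ x ℕ./ c
  prev-/ x = [s+qc]/c≡q _ (x ℕ./ c) (ℕ.m%n<n (x % c ℕ.+ c′) c)

  cycSucc≡next : ∀ a b → cycSucc c a b ≡ (next a ≡ᵇ b)
  cycSucc≡next a b = ≡-from-T to from
    where
    to : T (cycSucc c a b) → T (next a ≡ᵇ b)
    to t with Equivalence.to T-∧ t
    ... | /≡ , %≡ = ℕ.≡⇒≡ᵇ _ _ (≡-from-%-/ (next a) b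
                      (trans (next-% a) (ℕ.≡ᵇ⇒≡ ((a % c ℕ.+ 1) % c) (b % c) %≡))
                      (trans (next-/ a) (ℕ.≡ᵇ⇒≡ (a ℕ./ c) (b ℕ./ c) /≡)))
    from : T (next a ≡ᵇ b) → T (cycSucc c a b)
    from t = subst (T ∘ cycSucc c a) (ℕ.≡ᵇ⇒≡ (next a) b t)
      (Equivalence.from T-∧ (ℕ.≡⇒≡ᵇ _ _ (sym (next-/ a)) , ℕ.≡⇒≡ᵇ _ _ (sym (next-% a))))

  cycSucc≡prev : ∀ a b → cycSucc c b a ≡ (prev a ≡ᵇ b)
  cycSucc≡prev a b = ≡-from-T to from
    where
    to : T (cycSucc c b a) → T (prev a ≡ᵇ b)
    to t with Equivalence.to T-∧ t
    ... | /≡ , %≡ = ℕ.≡⇒≡ᵇ _ _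
                      (≡-from-%-/ (prev a) b prev-%≡ (trans (prev-/ a) (sym (ℕ.≡ᵇ⇒≡ (b ℕ./ c) (a ℕ./ c) /≡))))
      where
      prev-%≡ : prev a % c ≡ b % c
      prev-%≡ = begin
        prev a % c                        ≡⟨ prev-% a ⟩
        (a % c ℕ.+ c′) % c
          ≡⟨ cong (λ r → (r ℕ.+ c′) % c) (ℕ.≡ᵇ⇒≡ ((b % c ℕ.+ 1) % c) (a % c) %≡) ⟨
        ((b % c ℕ.+ 1) % c ℕ.+ c′) % c    ≡⟨ [x%c+y]%c≡[x+y]%c (b % c ℕ.+ 1) c′ ⟩
        (b % c ℕ.+ 1 ℕ.+ c′) % c          ≡⟨ [x+1+c′]%c≡x%c (b % c) ⟩
        b % c % c                         ≡⟨ ℕ.m%n%n≡m%n b c ⟩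
        b % c                             ∎
        where open ≡-Reasoning
    from : T (prev a ≡ᵇ b) → T (cycSucc c b a)
    from t = subst (λ b → T (cycSucc c b a)) (ℕ.≡ᵇ⇒≡ (prev a) b t)
      (Equivalence.from T-∧ (ℕ.≡⇒≡ᵇ _ _ (prev-/ a) , ℕ.≡⇒≡ᵇ _ _ prev-%-next))
      where
      prev-%-next : (prev a % c ℕ.+ 1) % c ≡ a % c
      prev-%-next = begin
        (prev a % c ℕ.+ 1) % c            ≡⟨ cong (λ r → (r ℕ.+ 1) % c) (prev-% a) ⟩
        ((a % c ℕ.+ c′) % c ℕ.+ 1) % c    ≡⟨ [x%c+y]%c≡[x+y]%c (a % c ℕ.+ c′) 1 ⟩
        (a % c ℕ.+ c′ ℕ.+ 1) % c          ≡⟨ [x+c′+1]%c≡x%c (a % c) ⟩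
        a % c % c                         ≡⟨ ℕ.m%n%n≡m%n a c ⟩
        a % c                             ∎
        where open ≡-Reasoning

  s+[x/c]c<mc : ∀ m x s → s ℕ.< c → x ℕ.< m ℕ.* c → s ℕ.+ (x ℕ./ c) ℕ.* c ℕ.< m ℕ.* c
  s+[x/c]c<mc m x s s<c x<mc = ℕ.≤-trans (ℕ.+-monoˡ-< ((x ℕ./ c) ℕ.* c) s<c)
                                 (ℕ.*-monoˡ-≤ c (ℕ.m<n*o⇒m/o<n {x} {m} {c} x<mc))

  next-< : ∀ m x → x ℕ.< m ℕ.* c → next x ℕ.< m ℕ.* c
  next-< m x = s+[x/c]c<mc m x _ (ℕ.m%n<n (x % c ℕ.+ 1) c)

  prev-< : ∀ m x → x ℕ.< m ℕ.* c → prev x ℕ.< m ℕ.* c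
  prev-< m x = s+[x/c]c<mc m x _ (ℕ.m%n<n (x % c ℕ.+ c′) c)

  -- The (x, k) entry of ((P + Pᵀ)/4)ʲ, P the shift along the cycles of length c.
  cycleWalk : ℕ → ℕ → ℕ → ℚ
  cycleWalk zero    k x = ind (x ≡ᵇ k)
  cycleWalk (suc j) k x = ¼ * (cycleWalk j k (next x) + cycleWalk j k (prev x))

  -- The displacement r − s around a cycle lifts to r − s + kc on ℤ, and walks of
  -- length at most c only reach the lifts with k ∈ {−1, 0, 1}.
  lifted : ℕ → ℕ → ℕ → ℚ
  lifted j r s = lineWalk j (r ⊖ s) + lineWalk j (r ⊖ (s ℕ.+ c)) + lineWalk j ((r ℕ.+ c) ⊖ s)

  -- Stepping past the end of the cycle (r = c − 1) permutes the three lifts; the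
  -- lifts that become unreachable carry weight 0 because j < c.
  lifted-next : ∀ j r s → j ℕ.< c → r ℕ.< c → s ℕ.< c →
    lifted j ((r ℕ.+ 1) % c) s ≡
      lineWalk j (ℤ.suc (r ⊖ s)) + lineWalk j (ℤ.suc (r ⊖ (s ℕ.+ c))) + lineWalk j (ℤ.suc ((r ℕ.+ c) ⊖ s))
  lifted-next j r s j<c r<c s<c
    rewrite sym (suc-⊖ r s) | sym (suc-⊖ r (s ℕ.+ c)) | sym (suc-⊖ (r ℕ.+ c) s) | ℕ.+-comm r 1
    with ℕ.m≤n⇒m<n∨m≡n (ℕ.s≤s⁻¹ r<c)
  ... | inj₁ r<c′ rewrite ℕ.m<n⇒m%n≡m (ℕ.s≤s r<c′) = refl
  ... | inj₂ refl
    rewrite c%c≡0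
          | lineWalk-below j 0 (s ℕ.+ c) (subst (ℕ._< s ℕ.+ c) (sym (ℕ.+-identityʳ j)) (ℕ.<-≤-trans j<c (ℕ.m≤n+m c s)))
          | lineWalk-above j (suc (c′ ℕ.+ c)) s (ℕ.+-mono-< j<c s<c)
          | trans (cong₂ _⊖_ (sym (ℕ.+-identityʳ c)) (ℕ.+-comm s c)) (ℤ.+-cancelˡ-⊖ c 0 s)
    = solve 2 (λ x y → x :+ con 0ℚ :+ y := y :+ x :+ con 0ℚ) refl (lineWalk j (0 ⊖ s)) (lineWalk j (c ⊖ s))

  lifted-prev : ∀ j r s → j ℕ.< c → r ℕ.< c → s ℕ.< c →
    lifted j ((r ℕ.+ c′) % c) s ≡
      lineWalk j (ℤ.pred (r ⊖ s)) + lineWalk j (ℤ.pred (r ⊖ (s ℕ.+ c))) + lineWalk j (ℤ.pred ((r ℕ.+ c) ⊖ s))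
  lifted-prev j (suc r) s j<c r<c s<c
    rewrite sym (⊖-suc (suc r) s) | sym (⊖-suc (suc r) (s ℕ.+ c)) | sym (⊖-suc (suc (r ℕ.+ c)) s)
          | ℤ.[1+m]⊖[1+n]≡m⊖n r s | ℤ.[1+m]⊖[1+n]≡m⊖n r (s ℕ.+ c) | ℤ.[1+m]⊖[1+n]≡m⊖n (r ℕ.+ c) s
          | sym (ℕ.+-suc r c′) | [x+c]%c≡x%c r | ℕ.m<n⇒m%n≡m (ℕ.<-trans (ℕ.n<1+n r) r<c) = refl
  lifted-prev j zero s j<c r<c s<c
    rewrite ℕ.m<n⇒m%n≡m (ℕ.n<1+n c′)
          | sym (⊖-suc 0 s) | sym (⊖-suc 0 (s ℕ.+ c)) | sym (⊖-suc c s)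
          | lineWalk-below j 0 (suc (s ℕ.+ c))
              (subst (ℕ._< suc (s ℕ.+ c)) (sym (ℕ.+-identityʳ j)) (ℕ.<-≤-trans j<c (ℕ.m≤n⇒m≤1+n (ℕ.m≤n+m c s))))
          | lineWalk-above j (c′ ℕ.+ c) s (subst (j ℕ.+ s ℕ.<_) (ℕ.+-comm c c′) (ℕ.+-mono-<-≤ j<c (ℕ.s≤s⁻¹ s<c)))
          | ℤ.[1+m]⊖[1+n]≡m⊖n c′ s
          | trans (cong₂ _⊖_ (sym (ℕ.+-identityʳ c′)) (trans (ℕ.+-comm s c) (sym (ℕ.+-suc c′ s))))
                  (ℤ.+-cancelˡ-⊖ c′ 0 (suc s))
    = solve 2 (λ x y → x :+ y :+ con 0ℚ := y :+ con 0ℚ :+ x) refl (lineWalk j (c′ ⊖ s)) (lineWalk j -[1+ s ])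

  cycleWalk-lift : ∀ j k x → j ℕ.≤ c → x ℕ./ c ≡ k ℕ./ c → cycleWalk j k x ≡ lifted j (x % c) (k % c)
  cycleWalk-lift zero k x _ x/c≡k/c = begin
    ind (x ≡ᵇ k)                                   ≡⟨ cong ind (≡-from-T to from) ⟩
    ind (x % c ≡ᵇ k % c)                           ≡⟨ lineWalk-zero (x % c) (k % c) ⟨
    lineWalk 0 (x % c ⊖ k % c)                     ≡⟨ solve 1 (λ a → a := a :+ con 0ℚ :+ con 0ℚ) refl _ ⟩
    lineWalk 0 (x % c ⊖ k % c) + 0ℚ + 0ℚ           ≡⟨ cong₂ (λ u v → lineWalk 0 (x % c ⊖ k % c) + u + v)
         (lineWalk-below 0 (x % c) (k % c ℕ.+ c) (ℕ.<-≤-trans (ℕ.m%n<n x c) (ℕ.m≤n+m c (k % c))))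
         (lineWalk-above 0 (x % c ℕ.+ c) (k % c) (ℕ.<-≤-trans (ℕ.m%n<n k c) (ℕ.m≤n+m c (x % c)))) ⟨
    lifted 0 (x % c) (k % c)                       ∎
    where
    open ≡-Reasoning
    to : T (x ≡ᵇ k) → T (x % c ≡ᵇ k % c)
    to t = ℕ.≡⇒≡ᵇ (x % c) (k % c) (cong (_% c) (ℕ.≡ᵇ⇒≡ x k t))
    from : T (x % c ≡ᵇ k % c) → T (x ≡ᵇ k)
    from t = ℕ.≡⇒≡ᵇ x k (≡-from-%-/ x k (ℕ.≡ᵇ⇒≡ (x % c) (k % c) t) x/c≡k/c)
  cycleWalk-lift (suc j) k x j<c x/c≡k/c = begin
    ¼ * (cycleWalk j k (next x) + cycleWalk j k (prev x))
      ≡⟨ cong₂ (λ u v → ¼ * (u + v))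
           (cycleWalk-lift j k (next x) (ℕ.<⇒≤ j<c) (trans (next-/ x) x/c≡k/c))
           (cycleWalk-lift j k (prev x) (ℕ.<⇒≤ j<c) (trans (prev-/ x) x/c≡k/c)) ⟩
    ¼ * (lifted j (next x % c) s + lifted j (prev x % c) s)
      ≡⟨ cong₂ (λ u v → ¼ * (lifted j u s + lifted j v s)) (next-% x) (prev-% x) ⟩
    ¼ * (lifted j ((r ℕ.+ 1) % c) s + lifted j ((r ℕ.+ c′) % c) s)
      ≡⟨ cong₂ (λ u v → ¼ * (u + v)) (lifted-next j r s j<c r<c s<c) (lifted-prev j r s j<c r<c s<c) ⟩
    ¼ * ((W (ℤ.suc d₁) + W (ℤ.suc d₂) + W (ℤ.suc d₃)) + (W (ℤ.pred d₁) + W (ℤ.pred d₂) + W (ℤ.pred d₃)))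
      ≡⟨ solve 6 (λ a b c d e f → con ¼ :* ((a :+ b :+ c) :+ (d :+ e :+ f))
                   := con ¼ :* (a :+ d) :+ con ¼ :* (b :+ e) :+ con ¼ :* (c :+ f)) refl
           (W (ℤ.suc d₁)) (W (ℤ.suc d₂)) (W (ℤ.suc d₃)) (W (ℤ.pred d₁)) (W (ℤ.pred d₂)) (W (ℤ.pred d₃)) ⟩
    lifted (suc j) r s ∎
    where
    open ≡-Reasoning
    W : ℤ → ℚ
    W = lineWalk j
    r s : ℕ
    r = x % c
    s = k % c
    r<c : r ℕ.< c
    r<c = ℕ.m%n<n x c
    s<c : s ℕ.< c
    s<c = ℕ.m%n<n k c
    d₁ d₂ d₃ : ℤ
    d₁ = r ⊖ s
    d₂ = r ⊖ (s ℕ.+ c)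
    d₃ = (r ℕ.+ c) ⊖ s

  cycleWalk-diagonal : ∀ j k → j ℕ.< c → cycleWalk j k k ≡ lineWalk j (+ 0)
  cycleWalk-diagonal j k j<c = begin
    cycleWalk j k k                          ≡⟨ cycleWalk-lift j k k (ℕ.<⇒≤ j<c) refl ⟩
    lineWalk j (s ⊖ s) + lineWalk j (s ⊖ (s ℕ.+ c)) + lineWalk j ((s ℕ.+ c) ⊖ s)
      ≡⟨ cong₂ (λ u v → lineWalk j (s ⊖ s) + u + v)
           (lineWalk-below j s (s ℕ.+ c) j+s<s+c) (lineWalk-above j (s ℕ.+ c) s j+s<s+c) ⟩
    lineWalk j (s ⊖ s) + 0ℚ + 0ℚ             ≡⟨ cong (λ z → lineWalk j z + 0ℚ + 0ℚ) (ℤ.n⊖n≡0 s) ⟩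
    lineWalk j (+ 0) + 0ℚ + 0ℚ               ≡⟨ solve 1 (λ a → a :+ con 0ℚ :+ con 0ℚ := a) refl _ ⟩
    lineWalk j (+ 0)                         ∎
    where
    open ≡-Reasoning
    s : ℕ
    s = k % c
    j+s<s+c : j ℕ.+ s ℕ.< s ℕ.+ c
    j+s<s+c = subst (ℕ._< s ℕ.+ c) (ℕ.+-comm s j) (ℕ.+-monoʳ-< s j<c)

  cycleWalk-bounds : ∀ j k x → 0ℚ ≤ cycleWalk j k x × cycleWalk j k x ≤ ½^ j
  cycleWalk-bounds zero    k x = ind-bounds (x ≡ᵇ k)
  cycleWalk-bounds (suc j) k x with cycleWalk-bounds j k (next x) | cycleWalk-bounds j k (prev x)
  ... | 0≤u , u≤p | 0≤v , v≤p =
    ¼-mono-≤ 0≤u 0≤v ,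
    subst (¼ * (cycleWalk j k (next x) + cycleWalk j k (prev x)) ≤_)
          (solve 1 (λ p → con ¼ :* (p :+ p) := con ½ :* p) refl (½^ j)) (¼-mono-≤ u≤p v≤p)

-- The cycle graphs

-- The contribution of J/N to each entry of the cycle block of Wʲ.
uniformPart : ℚ → ℕ → ℚ
uniformPart ε zero    = 0ℚ
uniformPart ε (suc j) = ½ * uniformPart ε j + ε

uniformPart-bounds : ∀ {ε} → 0ℚ ≤ ε → ε ≤ ½ → ∀ j → 0ℚ ≤ uniformPart ε j × uniformPart ε j + ½^ j ≤ 1ℚ
uniformPart-bounds         0≤ε ε≤½ zero    = ≤-refl , ≤-refl
uniformPart-bounds {ε} 0≤ε ε≤½ (suc j) with uniformPart-bounds 0≤ε ε≤½ j
... | 0≤u , u+p≤1 = +-mono-≤ (*-monoˡ-≤-nonNeg ½ 0≤u) 0≤ε , (begin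
  ½ * u + ε + ½ * p   ≡⟨ solve 3 (λ u e p → con ½ :* u :+ e :+ con ½ :* p := con ½ :* (u :+ p) :+ e) refl u ε p ⟩
  ½ * (u + p) + ε     ≤⟨ +-mono-≤ (*-monoˡ-≤-nonNeg ½ u+p≤1) ε≤½ ⟩
  1ℚ                  ∎)
  where
  open ≤-Reasoning
  u p : ℚ
  u = uniformPart ε j
  p = ½^ j

module CycleGraph (n ℓ c′ m : ℕ) (0<n : 0 ℕ.< n) (0<ℓ : 0 ℕ.< ℓ)
                  (B≡mc : 2 ℕ.* n ℕ.* ℓ ≡ m ℕ.* suc c′) where

  open Cycle c′

  B N : ℕ
  B = 2 ℕ.* n ℕ.* ℓ
  N = 4 ℕ.* n ℕ.* ℓ

  W : Mat N
  W = cycleGraph n ℓ c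

  invN : ℚ
  invN = inv N

  N≡B+B : N ≡ B ℕ.+ B
  N≡B+B = trans (cong (ℕ._* ℓ) (ℕ.*-distribʳ-+ n 2 2)) (ℕ.*-distribʳ-+ ℓ (2 ℕ.* n) (2 ℕ.* n))

  0<B : 0 ℕ.< B
  0<B = ℕ.*-mono-< {0} {2 ℕ.* n} (ℕ.*-mono-< {0} {2} (ℕ.s≤s ℕ.z≤n) 0<n) 0<ℓ

  B≤N : B ℕ.≤ N
  B≤N = subst (B ℕ.≤_) (sym N≡B+B) (ℕ.m≤m+n B B)

  N∸B≡B : N ℕ.∸ B ≡ B
  N∸B≡B = trans (cong (ℕ._∸ B) N≡B+B) (ℕ.m+n∸m≡n B B)

  invN*B≡½ : invN * fromℕ B ≡ ½
  invN*B≡½ = begin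
    invN * fromℕ B                       ≡⟨ solve 2 (λ i b → i :* b := con ½ :* ((b :+ b) :* i)) refl invN (fromℕ B) ⟩
    ½ * ((fromℕ B + fromℕ B) * invN)     ≡⟨ cong (λ z → ½ * (z * invN)) (trans (cong fromℕ N≡B+B) (fromℕ-+ B B)) ⟨
    ½ * (fromℕ N * invN)                 ≡⟨ cong (½ *_) (fromℕ*inv N (ℕ.<-≤-trans 0<B B≤N)) ⟩
    ½                                    ∎
    where open ≡-Reasoning

  invN-nonNeg : 0ℚ ≤ invN
  invN-nonNeg = inv-nonNeg N

  invN≤½ : invN ≤ ½
  invN≤½ = begin
    invN              ≡⟨ *-identityʳ invN ⟨
    invN * 1ℚ         ≤⟨ *-monoˡ-≤-nonNeg invN {{nonNegative invN-nonNeg}} (1≤fromℕ B 0<B) ⟩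
    invN * fromℕ B    ≡⟨ invN*B≡½ ⟩
    ½                 ∎
    where open ≤-Reasoning

  invN*sumFin-mono-≤ : ∀ {f g : Fin N → ℚ} → (∀ y → f y ≤ g y) → invN * sumFin N f ≤ invN * sumFin N g
  invN*sumFin-mono-≤ f≤g = *-monoˡ-≤-nonNeg invN {{nonNegative invN-nonNeg}} (sumFin-mono-≤ N f≤g)

  W-cycle : ∀ x y → toℕ x ℕ.< B → toℕ y ℕ.< B →
    W x y ≡ (¼ * ind (cycSucc c (toℕ x) (toℕ y)) + ¼ * ind (cycSucc c (toℕ y) (toℕ x))) + invN
  W-cycle x y x<B y<B rewrite <ᵇ-true x<B | <ᵇ-true y<B = refl

  W-cycle-isolated : ∀ x y → toℕ x ℕ.< B → B ℕ.≤ toℕ y → W x y ≡ 0ℚ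
  W-cycle-isolated x y x<B B≤y rewrite <ᵇ-true x<B | <ᵇ-false B≤y | ≤ᵇ-false x<B = refl

  W-isolated : ∀ x y → B ℕ.≤ toℕ x → W x y ≡ ind (toℕ x ≡ᵇ toℕ y)
  W-isolated x y B≤x rewrite <ᵇ-false B≤x | ≤ᵇ-true B≤x with toℕ x ≡ᵇ toℕ y
  ... | true  = refl
  ... | false = refl

  W-sym : ∀ x y → W x y ≡ W y x
  W-sym x y with toℕ x ℕ.<? B | toℕ y ℕ.<? B
  ... | yes x<B | yes y<B rewrite W-cycle x y x<B y<B | W-cycle y x y<B x<B =
    cong (_+ invN) (+-comm (¼ * ind (cycSucc c (toℕ x) (toℕ y))) (¼ * ind (cycSucc c (toℕ y) (toℕ x))))
  ... | yes x<B | no y≮B rewrite W-cycle-isolated x y x<B (ℕ.≮⇒≥ y≮B) | W-isolated y x (ℕ.≮⇒≥ y≮B)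
                               | ≡ᵇ-false (ℕ.<⇒≢ (ℕ.<-≤-trans x<B (ℕ.≮⇒≥ y≮B)) ∘ sym) = refl
  ... | no x≮B | yes y<B rewrite W-cycle-isolated y x y<B (ℕ.≮⇒≥ x≮B) | W-isolated x y (ℕ.≮⇒≥ x≮B)
                               | ≡ᵇ-false (ℕ.<⇒≢ (ℕ.<-≤-trans y<B (ℕ.≮⇒≥ x≮B)) ∘ sym) = refl
  ... | no x≮B | no y≮B rewrite W-isolated x y (ℕ.≮⇒≥ x≮B) | W-isolated y x (ℕ.≮⇒≥ y≮B) =
    cong ind (≡ᵇ-comm (toℕ x) (toℕ y))

  onCycles : (ℕ → ℚ) → ℕ → ℚ
  onCycles V t = if t <ᵇ B then V t else 0ℚ

  onCycles-< : ∀ V {t} → t ℕ.< B → onCycles V t ≡ V t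
  onCycles-< V t<B rewrite <ᵇ-true t<B = refl

  onCycles-≥ : ∀ V {t} → B ℕ.≤ t → onCycles V t ≡ 0ℚ
  onCycles-≥ V B≤t rewrite <ᵇ-false B≤t = refl

  invN*cycleSum : ∀ a → invN * sumFin N (λ y → onCycles (λ _ → a) (toℕ y)) ≡ ½ * a
  invN*cycleSum a = begin
    invN * sumFin N (λ y → onCycles (λ _ → a) (toℕ y))   ≡⟨ cong (invN *_) (sumFin-if-< N B a 0ℚ B≤N) ⟩
    invN * (fromℕ B * a + fromℕ (N ℕ.∸ B) * 0ℚ)         ≡⟨ solve 4 (λ i b a r → i :* (b :* a :+ r :* con 0ℚ) := i :* b :* a)
                                                              refl invN (fromℕ B) a (fromℕ (N ℕ.∸ B)) ⟩
    invN * fromℕ B * a                                  ≡⟨ cong (_* a) invN*B≡½ ⟩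
    ½ * a                                               ∎
    where open ≡-Reasoning

  next-<B : ∀ {x} → x ℕ.< B → next x ℕ.< B
  next-<B {x} x<B = subst (next x ℕ.<_) (sym B≡mc) (next-< m x (subst (x ℕ.<_) B≡mc x<B))

  prev-<B : ∀ {x} → x ℕ.< B → prev x ℕ.< B
  prev-<B {x} x<B = subst (prev x ℕ.<_) (sym B≡mc) (prev-< m x (subst (x ℕ.<_) B≡mc x<B))

  W-row-cycle : ∀ x → toℕ x ℕ.< B → (V : ℕ → ℚ) →
    sumFin N (λ y → W x y * onCycles V (toℕ y))
      ≡ ¼ * V (next (toℕ x)) + ¼ * V (prev (toℕ x)) + invN * sumFin N (λ y → onCycles V (toℕ y))
  W-row-cycle x x<B V = begin
    sumFin N (λ y → W x y * V′ y)
      ≡⟨ sumFin-cong N split ⟩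
    sumFin N (λ y → (¼ * (S y * V′ y) + ¼ * (P y * V′ y)) + invN * V′ y)
      ≡⟨ sumFin-+ N _ _ ⟩
    sumFin N (λ y → ¼ * (S y * V′ y) + ¼ * (P y * V′ y)) + sumFin N (λ y → invN * V′ y)
      ≡⟨ cong₂ _+_ (sumFin-+ N _ _) (sumFin-*ˡ N invN V′) ⟩
    sumFin N (λ y → ¼ * (S y * V′ y)) + sumFin N (λ y → ¼ * (P y * V′ y)) + invN * sumFin N V′
      ≡⟨ cong (λ z → z + invN * sumFin N V′) (cong₂ _+_ (sumFin-*ˡ N ¼ _) (sumFin-*ˡ N ¼ _)) ⟩
    ¼ * sumFin N (λ y → S y * V′ y) + ¼ * sumFin N (λ y → P y * V′ y) + invN * sumFin N V′
      ≡⟨ cong₂ (λ u v → ¼ * u + ¼ * v + invN * sumFin N V′)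
           (select next (cycSucc≡next (toℕ x) ∘ toℕ) (next-<B x<B))
           (select prev (cycSucc≡prev (toℕ x) ∘ toℕ) (prev-<B x<B)) ⟩
    ¼ * V (next (toℕ x)) + ¼ * V (prev (toℕ x)) + invN * sumFin N V′ ∎
    where
    open ≡-Reasoning
    V′ : Fin N → ℚ
    V′ y = onCycles V (toℕ y)
    S P : Fin N → ℚ
    S y = ind (cycSucc c (toℕ x) (toℕ y))
    P y = ind (cycSucc c (toℕ y) (toℕ x))
    split : ∀ y → W x y * V′ y ≡ (¼ * (S y * V′ y) + ¼ * (P y * V′ y)) + invN * V′ y
    split y with toℕ y ℕ.<? B
    ... | yes y<B rewrite W-cycle x y x<B y<B | onCycles-< V y<B =
      solve 4 (λ s p i v → (con ¼ :* s :+ con ¼ :* p :+ i) :* v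
                           := con ¼ :* (s :* v) :+ con ¼ :* (p :* v) :+ i :* v) refl (S y) (P y) invN (V (toℕ y))
    ... | no y≮B rewrite W-cycle-isolated x y x<B (ℕ.≮⇒≥ y≮B) | onCycles-≥ V (ℕ.≮⇒≥ y≮B) =
      solve 3 (λ s p i → con 0ℚ :* con 0ℚ := con ¼ :* (s :* con 0ℚ) :+ con ¼ :* (p :* con 0ℚ) :+ i :* con 0ℚ)
        refl (S y) (P y) invN
    select : ∀ (f : ℕ → ℕ) {E : Fin N → Bool} → (∀ y → E y ≡ (f (toℕ x) ≡ᵇ toℕ y)) → f (toℕ x) ℕ.< B →
             sumFin N (λ y → ind (E y) * V′ y) ≡ V (f (toℕ x))
    select f {E} E≡ fx<B = begin
      sumFin N (λ y → ind (E y) * V′ y)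
        ≡⟨ sumFin-cong N (λ y → cong (λ b → ind b * V′ y) (E≡ y)) ⟩
      sumFin N (λ y → ind (f (toℕ x) ≡ᵇ toℕ y) * V′ y)
        ≡⟨ sumFin-selectℕ N (f (toℕ x)) (ℕ.<-≤-trans fx<B B≤N) (onCycles V) ⟩
      onCycles V (f (toℕ x))
        ≡⟨ onCycles-< V fx<B ⟩
      V (f (toℕ x))
        ∎

  W-row-isolated : ∀ x → B ℕ.≤ toℕ x → (f : Fin N → ℚ) → sumFin N (λ y → W x y * f y) ≡ f x
  W-row-isolated x B≤x f = trans (sumFin-cong N (λ y → cong (_* f y) (W-isolated x y B≤x))) (sumFin-select N x f)

  degree≡1 : ∀ x → degree W x ≡ 1ℚ
  degree≡1 x with toℕ x ℕ.<? B
  ... | yes x<B = begin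
    sumFin N (W x)                                        ≡⟨ sumFin-cong N restrict ⟩
    sumFin N (λ y → W x y * onCycles (λ _ → 1ℚ) (toℕ y))  ≡⟨ W-row-cycle x x<B (λ _ → 1ℚ) ⟩
    ¼ * 1ℚ + ¼ * 1ℚ + invN * sumFin N (λ y → onCycles (λ _ → 1ℚ) (toℕ y))
      ≡⟨ cong (_+_ (¼ * 1ℚ + ¼ * 1ℚ)) (invN*cycleSum 1ℚ) ⟩
    ¼ * 1ℚ + ¼ * 1ℚ + ½ * 1ℚ                              ≡⟨⟩
    1ℚ                                                    ∎
    where
    open ≡-Reasoning
    restrict : ∀ y → W x y ≡ W x y * onCycles (λ _ → 1ℚ) (toℕ y)
    restrict y with toℕ y ℕ.<? B
    ... | yes y<B rewrite onCycles-< (λ _ → 1ℚ) y<B = sym (*-identityʳ (W x y))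
    ... | no y≮B rewrite onCycles-≥ (λ _ → 1ℚ) (ℕ.≮⇒≥ y≮B) | W-cycle-isolated x y x<B (ℕ.≮⇒≥ y≮B) = refl
  ... | no x≮B = trans (sumFin-cong N (λ y → sym (*-identityʳ (W x y)))) (W-row-isolated x (ℕ.≮⇒≥ x≮B) (λ _ → 1ℚ))

  W-colSum≡1 : ∀ y → sumFin N (λ x → W x y) ≡ 1ℚ
  W-colSum≡1 y = trans (sumFin-cong N (λ x → W-sym x y)) (degree≡1 y)

  matPow-colSum≡1 : ∀ j y → sumFin N (λ x → matPow W j x y) ≡ 1ℚ
  matPow-colSum≡1 zero    y = trans
    (sumFin-cong N (λ x → trans (cong ind (≡ᵇ-comm (toℕ x) (toℕ y))) (sym (*-identityʳ _))))
    (sumFin-select N y (λ _ → 1ℚ))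
  matPow-colSum≡1 (suc j) y = begin
    sumFin N (λ x → sumFin N (λ z → W x z * Wʲ z))   ≡⟨ sumFin-comm N N (λ x z → W x z * Wʲ z) ⟩
    sumFin N (λ z → sumFin N (λ x → W x z * Wʲ z))   ≡⟨ sumFin-cong N column ⟩
    sumFin N Wʲ                                      ≡⟨ matPow-colSum≡1 j y ⟩
    1ℚ                                               ∎
    where
    open ≡-Reasoning
    Wʲ : Fin N → ℚ
    Wʲ z = matPow W j z y
    column : ∀ z → sumFin N (λ x → W x z * Wʲ z) ≡ Wʲ z
    column z = begin
      sumFin N (λ x → W x z * Wʲ z)   ≡⟨ sumFin-cong N (λ x → *-comm (W x z) (Wʲ z)) ⟩
      sumFin N (λ x → Wʲ z * W x z)   ≡⟨ sumFin-*ˡ N (Wʲ z) (λ x → W x z) ⟩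
      Wʲ z * sumFin N (λ x → W x z)   ≡⟨ cong (Wʲ z *_) (W-colSum≡1 z) ⟩
      Wʲ z * 1ℚ                       ≡⟨ *-identityʳ (Wʲ z) ⟩
      Wʲ z                            ∎

  matPow-cycleColumn : ∀ j y → toℕ y ℕ.< B → ∀ x →
    matPow W j x y ≡ onCycles (λ t → cycleWalk j (toℕ y) t + uniformPart invN j) (toℕ x)
  matPow-cycleColumn zero y y<B x with toℕ x ℕ.<? B
  ... | yes x<B rewrite onCycles-< (λ t → cycleWalk 0 (toℕ y) t + 0ℚ) x<B = sym (+-identityʳ _)
  ... | no x≮B rewrite onCycles-≥ (λ t → cycleWalk 0 (toℕ y) t + 0ℚ) (ℕ.≮⇒≥ x≮B)
                     | ≡ᵇ-false (ℕ.<⇒≢ (ℕ.<-≤-trans y<B (ℕ.≮⇒≥ x≮B)) ∘ sym) = refl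
  matPow-cycleColumn (suc j) y y<B x with toℕ x ℕ.<? B
  ... | yes x<B = begin
    sumFin N (λ z → W x z * matPow W j z y)
      ≡⟨ sumFin-cong N (λ z → cong (W x z *_) (matPow-cycleColumn j y y<B z)) ⟩
    sumFin N (λ z → W x z * onCycles V (toℕ z))
      ≡⟨ W-row-cycle x x<B V ⟩
    ¼ * V (next x′) + ¼ * V (prev x′) + invN * sumFin N (λ z → onCycles V (toℕ z))
      ≡⟨ cong (λ s → ¼ * V (next x′) + ¼ * V (prev x′) + invN * s)
           (trans (sumFin-cong N (λ z → sym (matPow-cycleColumn j y y<B z))) (matPow-colSum≡1 j y)) ⟩
    ¼ * V (next x′) + ¼ * V (prev x′) + invN * 1ℚ
      ≡⟨ solve 4 (λ u v a i → con ¼ :* (u :+ a) :+ con ¼ :* (v :+ a) :+ i :* con 1ℚ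
                              := con ¼ :* (u :+ v) :+ (con ½ :* a :+ i)) refl
           (cycleWalk j (toℕ y) (next x′)) (cycleWalk j (toℕ y) (prev x′)) (uniformPart invN j) invN ⟩
    cycleWalk (suc j) (toℕ y) x′ + uniformPart invN (suc j)
      ≡⟨ onCycles-< (λ t → cycleWalk (suc j) (toℕ y) t + uniformPart invN (suc j)) x<B ⟨
    onCycles (λ t → cycleWalk (suc j) (toℕ y) t + uniformPart invN (suc j)) x′ ∎
    where
    open ≡-Reasoning
    V : ℕ → ℚ
    V t = cycleWalk j (toℕ y) t + uniformPart invN j
    x′ : ℕ
    x′ = toℕ x
  ... | no x≮B = begin
    sumFin N (λ z → W x z * matPow W j z y)
      ≡⟨ W-row-isolated x (ℕ.≮⇒≥ x≮B) (λ z → matPow W j z y) ⟩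
    matPow W j x y
      ≡⟨ matPow-cycleColumn j y y<B x ⟩
    onCycles (λ t → cycleWalk j (toℕ y) t + uniformPart invN j) (toℕ x)
      ≡⟨ onCycles-≥ (λ t → cycleWalk j (toℕ y) t + uniformPart invN j) (ℕ.≮⇒≥ x≮B) ⟩
    0ℚ
      ≡⟨ onCycles-≥ (λ t → cycleWalk (suc j) (toℕ y) t + uniformPart invN (suc j)) (ℕ.≮⇒≥ x≮B) ⟨
    onCycles (λ t → cycleWalk (suc j) (toℕ y) t + uniformPart invN (suc j)) (toℕ x) ∎
    where open ≡-Reasoning

  matPow-isolatedColumn : ∀ j y → B ℕ.≤ toℕ y → ∀ x → matPow W j x y ≡ ind (toℕ x ≡ᵇ toℕ y)
  matPow-isolatedColumn zero    y B≤y x = refl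
  matPow-isolatedColumn (suc j) y B≤y x = begin
    sumFin N (λ z → W x z * matPow W j z y)
      ≡⟨ sumFin-cong N (λ z → cong (W x z *_) (matPow-isolatedColumn j y B≤y z)) ⟩
    sumFin N (λ z → W x z * ind (toℕ z ≡ᵇ toℕ y))
      ≡⟨ sumFin-cong N (λ z → trans (*-comm (W x z) _) (cong (λ b → ind b * W x z) (≡ᵇ-comm (toℕ z) (toℕ y)))) ⟩
    sumFin N (λ z → ind (toℕ y ≡ᵇ toℕ z) * W x z)     ≡⟨ sumFin-select N y (W x) ⟩
    W x y                                             ≡⟨ W-into-isolated ⟩
    ind (toℕ x ≡ᵇ toℕ y)                              ∎
    where
    open ≡-Reasoning
    W-into-isolated : W x y ≡ ind (toℕ x ≡ᵇ toℕ y)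
    W-into-isolated with toℕ x ℕ.<? B
    ... | yes x<B rewrite W-cycle-isolated x y x<B B≤y | ≡ᵇ-false (ℕ.<⇒≢ (ℕ.<-≤-trans x<B B≤y)) = refl
    ... | no x≮B  = W-isolated x y (ℕ.≮⇒≥ x≮B)

  diagonalEntry : ℕ → ℕ → ℚ
  diagonalEntry j t = if t <ᵇ B then cycleWalk j t t + uniformPart invN j else 1ℚ

  moment≡ : ∀ j → moment W j ≡ invN * sumFin N (λ y → diagonalEntry j (toℕ y))
  moment≡ j = cong (invN *_) (sumFin-cong N diagonal)
    where
    diagonal : ∀ y → matPow W j y y ≡ diagonalEntry j (toℕ y)
    diagonal y with toℕ y ℕ.<? B
    ... | yes y<B rewrite matPow-cycleColumn j y y<B y | <ᵇ-true y<B = refl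
    ... | no y≮B  rewrite matPow-isolatedColumn j y (ℕ.≮⇒≥ y≮B) y | <ᵇ-false (ℕ.≮⇒≥ y≮B)
                        | T⇒≡true (ℕ.≡⇒≡ᵇ (toℕ y) (toℕ y) refl) = refl

  cycleEntry-bounds : ∀ j t → 0ℚ ≤ cycleWalk j t t + uniformPart invN j × cycleWalk j t t + uniformPart invN j ≤ 1ℚ
  cycleEntry-bounds j t =
    +-mono-≤ (proj₁ walk) (proj₁ uniform) , (begin
      cycleWalk j t t + uniformPart invN j   ≤⟨ +-monoˡ-≤ (uniformPart invN j) (proj₂ walk) ⟩
      ½^ j + uniformPart invN j             ≡⟨ +-comm (½^ j) (uniformPart invN j) ⟩
      uniformPart invN j + ½^ j             ≤⟨ proj₂ uniform ⟩
      1ℚ                                    ∎)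
    where
    open ≤-Reasoning
    walk : 0ℚ ≤ cycleWalk j t t × cycleWalk j t t ≤ ½^ j
    walk = cycleWalk-bounds j t t
    uniform : 0ℚ ≤ uniformPart invN j × uniformPart invN j + ½^ j ≤ 1ℚ
    uniform = uniformPart-bounds invN-nonNeg invN≤½ j

  diagonalEntry-bounds : ∀ j t → (if t <ᵇ B then 0ℚ else 1ℚ) ≤ diagonalEntry j t × diagonalEntry j t ≤ 1ℚ
  diagonalEntry-bounds j t with t <ᵇ B
  ... | false = ≤-refl , ≤-refl
  ... | true  = cycleEntry-bounds j t

  moment≤1 : ∀ j → moment W j ≤ 1ℚ
  moment≤1 j = begin
    moment W j                                        ≡⟨ moment≡ j ⟩
    invN * sumFin N (λ y → diagonalEntry j (toℕ y))
      ≤⟨ invN*sumFin-mono-≤ (λ y → proj₂ (diagonalEntry-bounds j (toℕ y))) ⟩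
    invN * sumFin N (λ _ → 1ℚ)                        ≡⟨ cong (invN *_) (trans (sumFin-const N 1ℚ) (*-identityʳ (fromℕ N))) ⟩
    invN * fromℕ N                                    ≡⟨ *-comm invN (fromℕ N) ⟩
    fromℕ N * invN                                    ≡⟨ fromℕ*inv N (ℕ.<-≤-trans 0<B B≤N) ⟩
    1ℚ                                                ∎
    where open ≤-Reasoning


  ½≤moment : ∀ j → ½ ≤ moment W j
  ½≤moment j = begin
    ½                                                      ≡⟨ invN*B≡½ ⟨
    invN * fromℕ B                                         ≡⟨ cong (invN *_) isolatedCount ⟨
    invN * sumFin N (λ y → if toℕ y <ᵇ B then 0ℚ else 1ℚ)
      ≤⟨ invN*sumFin-mono-≤ (λ y → proj₁ (diagonalEntry-bounds j (toℕ y))) ⟩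
    invN * sumFin N (λ y → diagonalEntry j (toℕ y))        ≡⟨ moment≡ j ⟨
    moment W j                                             ∎
    where
    open ≤-Reasoning
    isolatedCount : sumFin N (λ y → if toℕ y <ᵇ B then 0ℚ else 1ℚ) ≡ fromℕ B
    isolatedCount = begin-equality
      sumFin N (λ y → if toℕ y <ᵇ B then 0ℚ else 1ℚ)   ≡⟨ sumFin-if-< N B 0ℚ 1ℚ B≤N ⟩
      fromℕ B * 0ℚ + fromℕ (N ℕ.∸ B) * 1ℚ             ≡⟨ cong (λ z → fromℕ B * 0ℚ + fromℕ z * 1ℚ) N∸B≡B ⟩
      fromℕ B * 0ℚ + fromℕ B * 1ℚ                     ≡⟨ solve 1 (λ b → b :* con 0ℚ :+ b :* con 1ℚ := b) refl (fromℕ B) ⟩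
      fromℕ B                                         ∎

module CycleGraphPair (n ℓ c₁′ m₁ c₂′ m₂ : ℕ) (0<n : 0 ℕ.< n) (0<ℓ : 0 ℕ.< ℓ)
                      (B≡m₁c₁ : 2 ℕ.* n ℕ.* ℓ ≡ m₁ ℕ.* suc c₁′)
                      (B≡m₂c₂ : 2 ℕ.* n ℕ.* ℓ ≡ m₂ ℕ.* suc c₂′) where

  module G = CycleGraph n ℓ c₁′ m₁ 0<n 0<ℓ B≡m₁c₁
  module H = CycleGraph n ℓ c₂′ m₂ 0<n 0<ℓ B≡m₂c₂
  open G using (B; N; invN; invN*cycleSum; invN*sumFin-mono-≤)

  moments-agree : ∀ j → j ℕ.< suc c₁′ → j ℕ.< suc c₂′ → moment G.W j ≡ moment H.W j
  moments-agree j j<c₁ j<c₂ =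
    trans (G.moment≡ j) (trans (cong (invN *_) (sumFin-cong N sameDiagonal)) (sym (H.moment≡ j)))
    where
    sameDiagonal : ∀ y → G.diagonalEntry j (toℕ y) ≡ H.diagonalEntry j (toℕ y)
    sameDiagonal y = cong (λ w → if toℕ y <ᵇ B then w + uniformPart invN j else 1ℚ)
      (trans (Cycle.cycleWalk-diagonal c₁′ j (toℕ y) j<c₁) (sym (Cycle.cycleWalk-diagonal c₂′ j (toℕ y) j<c₂)))

  diagonalEntry-difference : ∀ j t →
    (if t <ᵇ B then - ½^ j else 0ℚ) ≤ G.diagonalEntry j t - H.diagonalEntry j t
    × G.diagonalEntry j t - H.diagonalEntry j t ≤ (if t <ᵇ B then ½^ j else 0ℚ)
  diagonalEntry-difference j t with t <ᵇ B
  ... | false = ≤-refl , ≤-refl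
  ... | true  = difference-bounds (proj₁ g) (proj₂ g) (proj₁ h) (proj₂ h)
    where
    g : 0ℚ ≤ Cycle.cycleWalk c₁′ j t t × Cycle.cycleWalk c₁′ j t t ≤ ½^ j
    g = Cycle.cycleWalk-bounds c₁′ j t t
    h : 0ℚ ≤ Cycle.cycleWalk c₂′ j t t × Cycle.cycleWalk c₂′ j t t ≤ ½^ j
    h = Cycle.cycleWalk-bounds c₂′ j t t

  moments-close : ∀ j → ∣ moment G.W j - moment H.W j ∣ ≤ ½ * ½^ j
  moments-close j = ∣p∣≤q lower upper
    where
    open ≤-Reasoning
    D : Fin N → ℚ
    D y = G.diagonalEntry j (toℕ y) - H.diagonalEntry j (toℕ y)
    invN*∑D : moment G.W j - moment H.W j ≡ invN * sumFin N D
    invN*∑D = begin-equality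
      moment G.W j - moment H.W j
        ≡⟨ cong₂ _-_ (G.moment≡ j) (H.moment≡ j) ⟩
      invN * sumFin N (λ y → G.diagonalEntry j (toℕ y)) - invN * sumFin N (λ y → H.diagonalEntry j (toℕ y))
        ≡⟨ solve 3 (λ i a b → i :* a :- i :* b := i :* (a :- b)) refl invN _ _ ⟩
      invN * (sumFin N (λ y → G.diagonalEntry j (toℕ y)) - sumFin N (λ y → H.diagonalEntry j (toℕ y)))
        ≡⟨ cong (invN *_) (sumFin-minus N _ _) ⟨
      invN * sumFin N D ∎
    upper : moment G.W j - moment H.W j ≤ ½ * ½^ j
    upper = begin
      moment G.W j - moment H.W j                                  ≡⟨ invN*∑D ⟩
      invN * sumFin N D
        ≤⟨ invN*sumFin-mono-≤ (λ y → proj₂ (diagonalEntry-difference j (toℕ y))) ⟩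
      invN * sumFin N (λ y → if toℕ y <ᵇ B then ½^ j else 0ℚ)     ≡⟨ invN*cycleSum (½^ j) ⟩
      ½ * ½^ j                                                     ∎
    lower : - (½ * ½^ j) ≤ moment G.W j - moment H.W j
    lower = begin
      - (½ * ½^ j)                                                 ≡⟨ neg-distribʳ-* ½ (½^ j) ⟩
      ½ * - ½^ j                                                   ≡⟨ invN*cycleSum (- ½^ j) ⟨
      invN * sumFin N (λ y → if toℕ y <ᵇ B then - ½^ j else 0ℚ)
        ≤⟨ invN*sumFin-mono-≤ (λ y → proj₁ (diagonalEntry-difference j (toℕ y))) ⟩
      invN * sumFin N D                                            ≡⟨ invN*∑D ⟨
      moment G.W j - moment H.W j                                  ∎

lemma10 : (ℓ : ℕ) → 0 ℕ.< ℓ → ℓ % 2 ≡ 1 →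
    (S₁ S₂ : Fin (4 ℕ.* ceil4 (2 ^ ℓ) ℕ.* ℓ) → ℚ) →
    IsInvSqrtDegree (G₁ (ceil4 (2 ^ ℓ)) ℓ) S₁ →
    IsInvSqrtDegree (G₂ (ceil4 (2 ^ ℓ)) ℓ) S₂ →
    ((j : ℕ) →
        (½ ≤ moment (normalized (G₁ (ceil4 (2 ^ ℓ)) ℓ) S₁) j)
      × (moment (normalized (G₁ (ceil4 (2 ^ ℓ)) ℓ) S₁) j ≤ 1ℚ)
      × (½ ≤ moment (normalized (G₂ (ceil4 (2 ^ ℓ)) ℓ) S₂) j)
      × (moment (normalized (G₂ (ceil4 (2 ^ ℓ)) ℓ) S₂) j ≤ 1ℚ))
    × ((j : ℕ) → j ℕ.< ℓ →
        ∣ moment (normalized (G₁ (ceil4 (2 ^ ℓ)) ℓ) S₁) j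
          - moment (normalized (G₂ (ceil4 (2 ^ ℓ)) ℓ) S₂) j ∣ ≡ 0ℚ)
    × ((j : ℕ) → ℓ ℕ.≤ j →
        ∣ moment (normalized (G₁ (ceil4 (2 ^ ℓ)) ℓ) S₁) j
          - moment (normalized (G₂ (ceil4 (2 ^ ℓ)) ℓ) S₂) j ∣
          ≤ inv (2 ^ ℓ) * (+ 2 / 1))
lemma10 ℓ@(suc ℓ′) 0<ℓ _ S₁ S₂ isInvSqrt₁ isInvSqrt₂ =
  (λ j → unnormalize (λ a b → (½ ≤ a) × (a ≤ 1ℚ) × (½ ≤ b) × (b ≤ 1ℚ)) j
           (P.G.½≤moment j , P.G.moment≤1 j , P.H.½≤moment j , P.H.moment≤1 j)) ,
  (λ j j<ℓ → unnormalize (λ a b → ∣ a - b ∣ ≡ 0ℚ) j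
           (cong ∣_∣ (trans (cong (_- moment P.H.W j) (P.moments-agree j j<ℓ (ℕ.m≤n⇒m≤n+o (suc (ℓ′ ℕ.+ 0)) j<ℓ)))
                            (+-inverseʳ (moment P.H.W j))))) ,
  (λ j ℓ≤j → unnormalize (λ a b → ∣ a - b ∣ ≤ inv (2 ^ ℓ) * (+ 2 / 1)) j
           (≤-trans (P.moments-close j) (½*½^j≤inv2^ℓ*2 ℓ≤j)))
  where
  n : ℕ
  n = ceil4 (2 ^ ℓ)
  0<n : 0 ℕ.< n
  0<n = ℕ.m≥n⇒m/n>0 {2 ^ ℓ ℕ.+ 3} {4} (ℕ.+-monoˡ-≤ 3 (ℕ.m^n>0 2 ℓ))
  module P = CycleGraphPair n ℓ ℓ′ (2 ℕ.* n) (ℓ′ ℕ.+ suc (ℓ′ ℕ.+ 0)) n 0<n 0<ℓ refl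
               (trans (cong (ℕ._* ℓ) (ℕ.*-comm 2 n)) (ℕ.*-assoc n 2 ℓ))
  unnormalize : ∀ (R : ℚ → ℚ → Set) j → R (moment P.G.W j) (moment P.H.W j) →
    R (moment (normalized (G₁ n ℓ) S₁) j) (moment (normalized (G₂ n ℓ) S₂) j)
  unnormalize R j = subst₂ R
    (sym (moment-normalized P.G.W (invSqrtDegree≡1 P.G.degree≡1 isInvSqrt₁) j))
    (sym (moment-normalized P.H.W (invSqrtDegree≡1 P.H.degree≡1 isInvSqrt₂) j))
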